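{- For all $n\ge 4$, $\mathrm{r}_n(1342)=2\,\mathrm{r}_{n-1}(1342)+\mathrm{r}_{n-2}(1342)+2$.
   Context: $\mathcal{S}_n$ is the set of permutations of $[n]$, $\pi^r$ the reversal of $\pi$. A word $w$ contains $\rho\in\mathcal{S}_k$ if some subsequence $w_{i_1}\cdots w_{i_k}$ ($i_1<\cdots<i_k$) satisfies $w_{i_a}\le w_{i_b}$ iff $\rho_a\le\rho_b$; otherwise it avoids $\rho$. $\mathcal{R}_n=\{\pi\pi^r:\pi\in\mathcal{S}_n\}$ (concatenation of $\pi$ with its reversal), and $\mathrm{r}_n(\rho)$ is the number of members of $\mathcal{R}_n$ avoiding $\rho$. -}

module Defs where

open import Data.Nat using (ℕ; zero; suc; _+_; _≤ᵇ_)
open import Data.Bool using (Bool; true; false; _∧_; if_then_else_)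
open import Data.List using (List; []; _∷_; _++_; map; concatMap; reverse; length; filter; upTo)
open import Data.Bool.ListAction using (all; any)

open import Data.Product using (_×_; _,_)

subseqs : {A : Set} → List A → List (List A)
subseqs []       = [] ∷ []
subseqs (x ∷ xs) = let r = subseqs xs in map (x ∷_) r ++ r

pairs : {A : Set} → List A → List (A × A)
pairs xs = concatMap (λ x → map (x ,_) xs) xs

zipL : {A B : Set} → List A → List B → List (A × B)
zipL [] _ = []
zipL _ [] = []
zipL (x ∷ xs) (y ∷ ys) = (x , y) ∷ zipL xs ys

_==ᵇ_ : Bool → Bool → Bool
true  ==ᵇ b = b
false ==ᵇ true = false
false ==ᵇ false = true

orderIso : List ℕ → List ℕ → Bool
orderIso u v =
  (length u Data.Nat.≡ᵇ length v) ∧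
  all (λ { ((ua , va) , (ub , vb)) → (ua ≤ᵇ ub) ==ᵇ (va ≤ᵇ vb) }) (pairs (zipL u v))

contains : List ℕ → List ℕ → Bool
contains w ρ = any (λ s → orderIso s ρ) (subseqs w)

avoids : List ℕ → List ℕ → Bool
avoids w ρ = Data.Bool.not (contains w ρ)

insertions : ℕ → List ℕ → List (List ℕ)
insertions x []       = (x ∷ []) ∷ []
insertions x (y ∷ ys) = (x ∷ y ∷ ys) ∷ map (y ∷_) (insertions x ys)

perms : ℕ → List (List ℕ)
perms zero    = [] ∷ []
perms (suc n) = concatMap (insertions (suc n)) (perms n)

Rn : ℕ → List (List ℕ)
Rn n = map (λ π → π ++ reverse π) (perms n)

r : ℕ → List ℕ → ℕ
r n ρ = length (filter (λ w → avoids w ρ Data.Bool.≟ true) (Rn n))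

-- Every π ∈ S(n + 1) is f ◂ σ for a unique first letter f and σ ∈ S(n), the letters after f being
-- order-isomorphic to σ; so r(n + 1) is a sum over f of the number of σ ∈ S(n) for which the double of
-- f ◂ σ avoids 1342. In the double x ⋯ x of a word starting with x, the outer copies of x can only act as
-- the 1 (needing a letter ≥ x + 3) or as the final 2 (needing a letter ≥ x + 2). Hence for f = n + 1 and
-- f = n the first letter can be deleted, giving r(n) twice. For 2 ≤ f ≤ n - 2 the letters f, n - 1, n, n + 1
-- or 1, f, n, n + 1 (according to the order of n and n + 1 in π) form a 1342. For f = n - 1 and f = 1 split
-- σ again by its first letter g: for f = n - 1 every g except n - 1 creates a 1342 and g = n - 1 gives
-- r(n - 1); for f = 1 every g except n creates a 1342 and g = n reduces to the same count in S(n), which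
-- is 2 by evaluation in S(4).

module Submission where

open import Defs
open import Data.Bool using (Bool; true; false; T; not; if_then_else_)
import Data.Bool
open import Data.Empty using (⊥-elim)
open import Data.List using (List; []; _∷_; _++_; [_]; map; concatMap; reverse; length; filter)
open import Data.List.Properties using (map-∘; map-++; reverse-map; unfold-reverse; ++-assoc)
open import Data.List.Membership.Propositional using (_∈_; _∉_; find; lose)
open import Data.List.Membership.Propositional.Properties
  using (∈-++⁺ˡ; ∈-++⁺ʳ; ∈-++⁻; ∈-map⁺; ∈-map⁻; ∈-concatMap⁻)
open import Data.List.Relation.Unary.All using ([]; _∷_)
open import Data.List.Relation.Unary.All.Properties using (all⁺; all⁻)
open import Data.List.Relation.Unary.Any using (here; there)
open import Data.List.Relation.Unary.Any.Properties using (any⁺; any⁻)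
import Data.List.Relation.Unary.Any.Properties as Any
open import Data.List.Relation.Binary.Sublist.Propositional
  using (_⊆_; []; _∷_; _∷ʳ_; minimum; ⊆-refl; ⊆-trans; from∈; lookup)
open import Data.List.Relation.Binary.Sublist.Propositional.Properties
  using (++⁺; ++⁺ʳ) renaming (map⁺ to ⊆-map⁺; reverse⁺ to ⊆-reverse⁺)
open import Data.Nat using (ℕ; zero; suc; _+_; _*_; _≤_; _<_; _≤ᵇ_; z≤n; s≤s; z<s; _≤?_)
open import Data.Nat.Properties
open import Algebra.Properties.CommutativeSemigroup +-commutativeSemigroup using (interchange)
open import Data.Nat.Solver using (module +-*-Solver)
open +-*-Solver using (solve; _:+_; _:*_; _:=_; con)
open import Data.Product using (_×_; _,_; ∃)
import Data.Product as Product
open import Data.Sum using (_⊎_; inj₁; inj₂; [_,_]′)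
import Data.Sum as Sum
open import Data.Unit using (tt)
open import Function using (_∘_; id)
open import Relation.Binary.Core using (_Preserves_⟶_)
open import Relation.Binary.Definitions using (tri<; tri≈; tri>)
open import Relation.Binary.PropositionalEquality
  using (_≡_; _≢_; refl; sym; trans; cong; cong₂; subst; module ≡-Reasoning)
open import Relation.Nullary using (yes; no)

private
  variable
    A : Set

sumOver : List A → (A → ℕ) → ℕ
sumOver []       h = 0
sumOver (x ∷ xs) h = h x + sumOver xs h

syntax sumOver xs (λ x → e) = ∑[ x ∈ xs ] e

sumOver-++ : ∀ xs ys (h : A → ℕ) → sumOver (xs ++ ys) h ≡ sumOver xs h + sumOver ys h
sumOver-++ []       ys h = refl
sumOver-++ (x ∷ xs) ys h = trans (cong (h x +_) (sumOver-++ xs ys h)) (sym (+-assoc (h x) _ _))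

sumOver-map : ∀ {B : Set} (g : A → B) xs (h : B → ℕ) → sumOver (map g xs) h ≡ sumOver xs (λ x → h (g x))
sumOver-map g []       h = refl
sumOver-map g (x ∷ xs) h = cong (h (g x) +_) (sumOver-map g xs h)

sumOver-concatMap : ∀ {B : Set} (g : A → List B) xs (h : B → ℕ) →
                    sumOver (concatMap g xs) h ≡ ∑[ x ∈ xs ] sumOver (g x) h
sumOver-concatMap g []       h = refl
sumOver-concatMap g (x ∷ xs) h =
  trans (sumOver-++ (g x) (concatMap g xs) h) (cong (sumOver (g x) h +_) (sumOver-concatMap g xs h))

sumOver-cong : ∀ xs {h k : A → ℕ} → (∀ {x} → x ∈ xs → h x ≡ k x) → sumOver xs h ≡ sumOver xs k
sumOver-cong []       e = refl
sumOver-cong (x ∷ xs) e = cong₂ _+_ (e (here refl)) (sumOver-cong xs (e ∘ there))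

sumOver-zero : ∀ xs {h : A → ℕ} → (∀ {x} → x ∈ xs → h x ≡ 0) → sumOver xs h ≡ 0
sumOver-zero []       e = refl
sumOver-zero (x ∷ xs) e = cong₂ _+_ (e (here refl)) (sumOver-zero xs (e ∘ there))

sumOver-+ : ∀ xs (h k : A → ℕ) → ∑[ x ∈ xs ] (h x + k x) ≡ sumOver xs h + sumOver xs k
sumOver-+ []       h k = refl
sumOver-+ (x ∷ xs) h k =
  trans (cong (h x + k x +_) (sumOver-+ xs h k)) (interchange (h x) (k x) _ _)

sumTo : ℕ → (ℕ → ℕ) → ℕ
sumTo zero    F = 0
sumTo (suc n) F = sumTo n F + F (suc n)

syntax sumTo n (λ f → e) = ∑[1≤ f ≤ n ] e

sumTo-cong : ∀ n {F G : ℕ → ℕ} → (∀ {f} → 1 ≤ f → f ≤ n → F f ≡ G f) → sumTo n F ≡ sumTo n G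
sumTo-cong zero    e = refl
sumTo-cong (suc n) e = cong₂ _+_ (sumTo-cong n (λ p q → e p (m≤n⇒m≤1+n q))) (e (s≤s z≤n) ≤-refl)

sumTo-zero : ∀ n {F : ℕ → ℕ} → (∀ {f} → 1 ≤ f → f ≤ n → F f ≡ 0) → sumTo n F ≡ 0
sumTo-zero zero    e = refl
sumTo-zero (suc n) e = cong₂ _+_ (sumTo-zero n (λ p q → e p (m≤n⇒m≤1+n q))) (e (s≤s z≤n) ≤-refl)

sumTo-head : ∀ n {F : ℕ → ℕ} → (∀ {f} → 2 ≤ f → f ≤ suc n → F f ≡ 0) → sumTo (suc n) F ≡ F 1
sumTo-head zero    e = refl
sumTo-head (suc n) {F} e = begin
  sumTo (suc n) F + F (2 + n)
    ≡⟨ cong₂ _+_ (sumTo-head n (λ p q → e p (m≤n⇒m≤1+n q))) (e (s≤s (s≤s z≤n)) ≤-refl) ⟩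
  F 1 + 0
    ≡⟨ +-identityʳ (F 1) ⟩
  F 1 ∎
  where open ≡-Reasoning

⊆-map⁻ : ∀ {B : Set} (g : A → B) ys {xs} → xs ⊆ map g ys → ∃ λ zs → zs ⊆ ys × map g zs ≡ xs
⊆-map⁻ g []       []         = [] , [] , refl
⊆-map⁻ g (y ∷ ys) (_ ∷ʳ p)   with zs , q , refl ← ⊆-map⁻ g ys p = zs , y ∷ʳ q , refl
⊆-map⁻ g (y ∷ ys) (refl ∷ p) with zs , q , refl ← ⊆-map⁻ g ys p = y ∷ zs , refl ∷ q , refl

⊆-++[]⁻ : ∀ xs ys {x y : A} → xs ++ [ x ] ⊆ ys ++ [ y ] → xs ++ [ x ] ⊆ ys ⊎ (x ≡ y × xs ⊆ ys)
⊆-++[]⁻ []          []       (refl ∷ [])   = inj₂ (refl , [])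
⊆-++[]⁻ (_ ∷ [])    []       (refl ∷ ())
⊆-++[]⁻ (_ ∷ _ ∷ _) []       (refl ∷ ())
⊆-++[]⁻ xs          (y ∷ ys) (_ ∷ʳ p)      = Sum.map (y ∷ʳ_) (Product.map₂ (y ∷ʳ_)) (⊆-++[]⁻ xs ys p)
⊆-++[]⁻ []          (y ∷ ys) (refl ∷ p)    = inj₁ (refl ∷ minimum ys)
⊆-++[]⁻ (_ ∷ xs)    (y ∷ ys) (refl ∷ p)    = Sum.map (refl ∷_) (Product.map₂ (refl ∷_)) (⊆-++[]⁻ xs ys p)

∈-∈-ordered : ∀ {x y : A} {w} → x ∈ w → y ∈ w → x ≢ y → x ∷ y ∷ [] ⊆ w ⊎ y ∷ x ∷ [] ⊆ w
∈-∈-ordered (here refl) (here refl) x≢y = ⊥-elim (x≢y refl)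
∈-∈-ordered (here refl) (there y∈)  _   = inj₁ (refl ∷ from∈ y∈)
∈-∈-ordered (there x∈)  (here refl) _   = inj₂ (refl ∷ from∈ x∈)
∈-∈-ordered {w = z ∷ w} (there x∈) (there y∈) x≢y = Sum.map (z ∷ʳ_) (z ∷ʳ_) (∈-∈-ordered x∈ y∈ x≢y)

-- Permutations by their first letter

punchIn : ℕ → ℕ → ℕ
punchIn f x = if f ≤ᵇ x then suc x else x

punchIn-≥ : ∀ {f x} → f ≤ x → punchIn f x ≡ suc x
punchIn-≥ {f} {x} f≤x with f ≤ᵇ x | ≤⇒≤ᵇ f≤x
... | true | _ = refl

punchIn-< : ∀ {f x} → x < f → punchIn f x ≡ x
punchIn-< {f} {x} x<f with f ≤ᵇ x in eq
... | false = refl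
... | true  = ⊥-elim (<⇒≱ x<f (≤ᵇ⇒≤ f x (subst T (sym eq) _)))

punchIn-≤ : ∀ f x → punchIn f x ≤ suc x
punchIn-≤ f x with f ≤ᵇ x
... | true  = ≤-refl
... | false = n≤1+n x

punchIn-mono-< : ∀ f → punchIn f Preserves _<_ ⟶ _<_
punchIn-mono-< f {x} {y} x<y with f ≤? x | f ≤? y
... | yes f≤x | yes f≤y rewrite punchIn-≥ f≤x | punchIn-≥ f≤y = s≤s x<y
... | yes f≤x | no  f≰y = ⊥-elim (f≰y (≤-trans f≤x (<⇒≤ x<y)))
... | no  f≰x | yes f≤y rewrite punchIn-< (≰⇒> f≰x) | punchIn-≥ f≤y = m<n⇒m<1+n x<y
... | no  f≰x | no  f≰y rewrite punchIn-< (≰⇒> f≰x) | punchIn-< (≰⇒> f≰y) = x<y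

punchIn²-≢-suc : ∀ f x → punchIn f (punchIn f x) ≢ suc f
punchIn²-≢-suc f x eq with f ≤? x
... | yes f≤x rewrite punchIn-≥ f≤x | punchIn-≥ (m≤n⇒m≤1+n f≤x) = <⇒≢ (s≤s f≤x) (sym (suc-injective eq))
... | no  f≰x rewrite punchIn-< (≰⇒> f≰x) | punchIn-< (≰⇒> f≰x) = <⇒≢ (m<n⇒m<1+n (≰⇒> f≰x)) eq

-- For σ ∈ S(n) and 1 ≤ f ≤ n + 1, f ◂ σ is the permutation of [n + 1] with first letter f whose
-- remaining letters are order-isomorphic to σ.

infixr 5 _◂_

_◂_ : ℕ → List ℕ → List ℕ
f ◂ σ = f ∷ map (punchIn f) σ

Bounded : ℕ → List ℕ → Set
Bounded n w = ∀ {x} → x ∈ w → x ≤ n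

Positive : List ℕ → Set
Positive w = ∀ {x} → x ∈ w → 1 ≤ x

Covers : ℕ → List ℕ → Set
Covers n w = ∀ {x} → 1 ≤ x → x ≤ n → x ∈ w

map-punchIn-id : ∀ {n} σ → Bounded n σ → map (punchIn (suc n)) σ ≡ σ
map-punchIn-id []      b = refl
map-punchIn-id (x ∷ σ) b = cong₂ _∷_ (punchIn-< (s≤s (b (here refl)))) (map-punchIn-id σ (b ∘ there))

◂-max : ∀ {n} σ → Bounded n σ → suc n ◂ σ ≡ suc n ∷ σ
◂-max σ b = cong (_ ∷_) (map-punchIn-id σ b)

Bounded-punchIn : ∀ {n} f σ → Bounded n σ → Bounded (suc n) (map (punchIn f) σ)
Bounded-punchIn f σ b x∈ with x , x∈σ , refl ← ∈-map⁻ (punchIn f) x∈ = ≤-trans (punchIn-≤ f x) (s≤s (b x∈σ))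

Bounded-++[] : ∀ {n y} w → Bounded n w → y ≤ n → Bounded n (w ++ [ y ])
Bounded-++[] w b y≤n x∈ with ∈-++⁻ w x∈
... | inj₁ x∈w        = b x∈w
... | inj₂ (here refl) = y≤n

module _ {x : ℕ} where

  ∈-insertions⁻ : ∀ {τ} τ′ → τ ∈ insertions x τ′ → ∀ {y} → y ∈ τ → y ≡ x ⊎ y ∈ τ′
  ∈-insertions⁻ []       (here refl) (here y≡x)  = inj₁ y≡x
  ∈-insertions⁻ (z ∷ τ′) (here refl) (here y≡x)  = inj₁ y≡x
  ∈-insertions⁻ (z ∷ τ′) (here refl) (there y∈) = inj₂ y∈
  ∈-insertions⁻ (z ∷ τ′) (there τ∈) y∈ with _ , τ₀∈ , refl ← ∈-map⁻ (z ∷_) τ∈ with y∈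
  ... | here y≡z  = inj₂ (here y≡z)
  ... | there y∈τ₀ = Sum.map₂ there (∈-insertions⁻ τ′ τ₀∈ y∈τ₀)

  ∈-insertions⁺ˡ : ∀ {τ} τ′ → τ ∈ insertions x τ′ → x ∈ τ
  ∈-insertions⁺ˡ []       (here refl) = here refl
  ∈-insertions⁺ˡ (z ∷ τ′) (here refl) = here refl
  ∈-insertions⁺ˡ (z ∷ τ′) (there τ∈) with _ , τ₀∈ , refl ← ∈-map⁻ (z ∷_) τ∈ = there (∈-insertions⁺ˡ τ′ τ₀∈)

  ∈-insertions⁺ʳ : ∀ {τ} τ′ → τ ∈ insertions x τ′ → ∀ {y} → y ∈ τ′ → y ∈ τ
  ∈-insertions⁺ʳ (z ∷ τ′) (here refl) y∈ = there y∈
  ∈-insertions⁺ʳ (z ∷ τ′) (there τ∈) y∈ with _ , τ₀∈ , refl ← ∈-map⁻ (z ∷_) τ∈ with y∈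
  ... | here y≡z   = here y≡z
  ... | there y∈τ′ = there (∈-insertions⁺ʳ τ′ τ₀∈ y∈τ′)

∈-perms-suc⁻ : ∀ {n τ} → τ ∈ perms (suc n) → ∃ λ τ′ → τ′ ∈ perms n × τ ∈ insertions (suc n) τ′
∈-perms-suc⁻ τ∈ = find (∈-concatMap⁻ (insertions _) τ∈)

perms-bounded : ∀ n {τ} → τ ∈ perms n → Bounded n τ
perms-bounded zero    (here refl) ()
perms-bounded (suc n) τ∈ y∈ with τ′ , τ′∈ , τ∈′ ← ∈-perms-suc⁻ {n} τ∈ with ∈-insertions⁻ τ′ τ∈′ y∈
... | inj₁ refl = ≤-refl
... | inj₂ y∈τ′ = m≤n⇒m≤1+n (perms-bounded n τ′∈ y∈τ′)

perms-positive : ∀ n {τ} → τ ∈ perms n → Positive τ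
perms-positive zero    (here refl) ()
perms-positive (suc n) τ∈ y∈ with τ′ , τ′∈ , τ∈′ ← ∈-perms-suc⁻ {n} τ∈ with ∈-insertions⁻ τ′ τ∈′ y∈
... | inj₁ refl = s≤s z≤n
... | inj₂ y∈τ′ = perms-positive n τ′∈ y∈τ′

perms-covers : ∀ n {τ} → τ ∈ perms n → Covers n τ
perms-covers zero    _  1≤y y≤0 = ⊥-elim (<⇒≱ 1≤y y≤0)
perms-covers (suc n) τ∈ 1≤y y≤1+n with τ′ , τ′∈ , τ∈′ ← ∈-perms-suc⁻ {n} τ∈ with m≤n⇒m<n∨m≡n y≤1+n
... | inj₁ y≤n  = ∈-insertions⁺ʳ τ′ τ∈′ (perms-covers n τ′∈ 1≤y (≤-pred y≤n))
... | inj₂ refl = ∈-insertions⁺ˡ τ′ τ∈′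

sumLaterInsertions : (List ℕ → ℕ) → ℕ → List ℕ → ℕ
sumLaterInsertions h x []       = 0
sumLaterInsertions h x (y ∷ ys) = ∑[ z ∈ insertions x ys ] h (y ∷ z)

sumOver-insertions : ∀ h x τ → sumOver (insertions x τ) h ≡ h (x ∷ τ) + sumLaterInsertions h x τ
sumOver-insertions h x []       = refl
sumOver-insertions h x (y ∷ ys) = cong (h (x ∷ y ∷ ys) +_) (sumOver-map (y ∷_) (insertions x ys) h)

insertions-map : ∀ (g : ℕ → ℕ) x σ → insertions (g x) (map g σ) ≡ map (map g) (insertions x σ)
insertions-map g x []      = refl
insertions-map g x (y ∷ σ) = cong ((g x ∷ g y ∷ map g σ) ∷_) (begin
  map (g y ∷_) (insertions (g x) (map g σ))   ≡⟨ cong (map (g y ∷_)) (insertions-map g x σ) ⟩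
  map (g y ∷_) (map (map g) (insertions x σ)) ≡⟨ map-∘ (insertions x σ) ⟨
  map (map g ∘ (y ∷_)) (insertions x σ)        ≡⟨ map-∘ (insertions x σ) ⟩
  map (map g) (map (y ∷_) (insertions x σ))   ∎)
  where open ≡-Reasoning

sumLaterInsertions-◂ : ∀ h {n f} → f ≤ suc n → ∀ σ →
                       sumLaterInsertions h (2 + n) (f ◂ σ) ≡ ∑[ τ ∈ insertions (suc n) σ ] h (f ◂ τ)
sumLaterInsertions-◂ h {n} {f} f≤ σ = begin
  ∑[ τ ∈ insertions (2 + n) (map (punchIn f) σ) ] h (f ∷ τ)
    ≡⟨ cong (λ x → ∑[ τ ∈ insertions x (map (punchIn f) σ) ] h (f ∷ τ)) (punchIn-≥ f≤) ⟨
  ∑[ τ ∈ insertions (punchIn f (suc n)) (map (punchIn f) σ) ] h (f ∷ τ)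
    ≡⟨ cong (λ τs → ∑[ τ ∈ τs ] h (f ∷ τ)) (insertions-map (punchIn f) (suc n) σ) ⟩
  ∑[ τ ∈ map (map (punchIn f)) (insertions (suc n) σ) ] h (f ∷ τ)
    ≡⟨ sumOver-map (map (punchIn f)) (insertions (suc n) σ) (λ τ → h (f ∷ τ)) ⟩
  ∑[ τ ∈ insertions (suc n) σ ] h (f ◂ τ) ∎
  where open ≡-Reasoning

sumOver-perms-suc : ∀ n (h : List ℕ → ℕ) →
                    ∑[ τ ∈ perms (suc n) ] h τ ≡ ∑[1≤ f ≤ suc n ] ∑[ σ ∈ perms n ] h (f ◂ σ)
sumOver-perms-suc zero    h = refl
sumOver-perms-suc (suc n) h = begin
  ∑[ τ ∈ perms (2 + n) ] h τ
    ≡⟨ sumOver-concatMap (insertions (2 + n)) (perms (suc n)) h ⟩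
  ∑[ τ ∈ perms (suc n) ] sumOver (insertions (2 + n) τ) h
    ≡⟨ sumOver-cong (perms (suc n)) (λ {τ} _ → sumOver-insertions h (2 + n) τ) ⟩
  ∑[ τ ∈ perms (suc n) ] (h (2 + n ∷ τ) + later τ)
    ≡⟨ sumOver-+ (perms (suc n)) (λ τ → h (2 + n ∷ τ)) later ⟩
  ∑[ τ ∈ perms (suc n) ] h (2 + n ∷ τ) + ∑[ τ ∈ perms (suc n) ] later τ
    ≡⟨ cong₂ _+_ (sumOver-cong (perms (suc n)) (λ τ∈ → cong h (sym (◂-max _ (perms-bounded (suc n) τ∈)))))
                 (sumOver-perms-suc n later) ⟩
  F (2 + n) + ∑[1≤ f ≤ suc n ] ∑[ σ ∈ perms n ] later (f ◂ σ)
    ≡⟨ cong (F (2 + n) +_) (sumTo-cong (suc n) (λ _ f≤ → regroup f≤)) ⟩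
  F (2 + n) + sumTo (suc n) F
    ≡⟨ +-comm (F (2 + n)) _ ⟩
  sumTo (suc n) F + F (2 + n) ∎
  where
  open ≡-Reasoning
  later = sumLaterInsertions h (2 + n)
  F : ℕ → ℕ
  F f = ∑[ σ ∈ perms (suc n) ] h (f ◂ σ)
  regroup : ∀ {f} → f ≤ suc n → ∑[ σ ∈ perms n ] later (f ◂ σ) ≡ F f
  regroup {f} f≤ = trans (sumOver-cong (perms n) (λ {σ} _ → sumLaterInsertions-◂ h f≤ σ))
                         (sym (sumOver-concatMap (insertions (suc n)) (perms n) (λ τ → h (f ◂ τ))))

-- Occurrences of 1342

ρ : List ℕ
ρ = 1 ∷ 3 ∷ 4 ∷ 2 ∷ []

record Contains1342 (w : List ℕ) : Set where
  constructor occurrence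
  field
    {a b c d} : ℕ
    embedding : a ∷ b ∷ c ∷ d ∷ [] ⊆ w
    a<d       : a < d
    d<b       : d < b
    b<c       : b < c

∈-subseqs⁺ : ∀ {xs w : List ℕ} → xs ⊆ w → xs ∈ subseqs w
∈-subseqs⁺ []                  = here refl
∈-subseqs⁺ {w = y ∷ w} (y ∷ʳ p) = ∈-++⁺ʳ (map (y ∷_) (subseqs w)) (∈-subseqs⁺ p)
∈-subseqs⁺ (refl ∷ p)          = ∈-++⁺ˡ (∈-map⁺ (_ ∷_) (∈-subseqs⁺ p))

∈-subseqs⁻ : ∀ {xs : List ℕ} w → xs ∈ subseqs w → xs ⊆ w
∈-subseqs⁻ []      (here refl) = []
∈-subseqs⁻ (x ∷ w) xs∈ with ∈-++⁻ (map (x ∷_) (subseqs w)) xs∈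
... | inj₁ xs∈′ with _ , ys∈ , refl ← ∈-map⁻ (x ∷_) xs∈′ = refl ∷ ∈-subseqs⁻ w ys∈
... | inj₂ xs∈′ = x ∷ʳ ∈-subseqs⁻ w xs∈′

≤⇒≤ᵇ==true : ∀ {x y} → x ≤ y → T ((x ≤ᵇ y) ==ᵇ true)
≤⇒≤ᵇ==true {x} {y} x≤y with x ≤ᵇ y | ≤⇒≤ᵇ x≤y
... | true | _ = tt

>⇒≤ᵇ==false : ∀ {x y} → y < x → T ((x ≤ᵇ y) ==ᵇ false)
>⇒≤ᵇ==false {x} {y} y<x with x ≤ᵇ y in eq
... | false = tt
... | true  = <⇒≱ y<x (≤ᵇ⇒≤ x y (subst T (sym eq) tt))

≤ᵇ==false⇒> : ∀ {x y} → T ((x ≤ᵇ y) ==ᵇ false) → y < x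
≤ᵇ==false⇒> {x} {y} t with x ≤ᵇ y in eq
... | false = ≰⇒> (λ x≤y → subst T eq (≤⇒≤ᵇ x≤y))

-- orderIso (a ∷ b ∷ c ∷ d ∷ []) ρ evaluates to the conjunction of this list, so all⁺ id and all⁻ id
-- translate it to and from a list of sixteen comparisons.

comparisons1342 : ℕ → ℕ → ℕ → ℕ → List Bool
comparisons1342 a b c d =
    (a ≤ᵇ a) ==ᵇ true  ∷ (a ≤ᵇ b) ==ᵇ true  ∷ (a ≤ᵇ c) ==ᵇ true  ∷ (a ≤ᵇ d) ==ᵇ true
  ∷ (b ≤ᵇ a) ==ᵇ false ∷ (b ≤ᵇ b) ==ᵇ true  ∷ (b ≤ᵇ c) ==ᵇ true  ∷ (b ≤ᵇ d) ==ᵇ false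
  ∷ (c ≤ᵇ a) ==ᵇ false ∷ (c ≤ᵇ b) ==ᵇ false ∷ (c ≤ᵇ c) ==ᵇ true  ∷ (c ≤ᵇ d) ==ᵇ false
  ∷ (d ≤ᵇ a) ==ᵇ false ∷ (d ≤ᵇ b) ==ᵇ true  ∷ (d ≤ᵇ c) ==ᵇ true  ∷ (d ≤ᵇ d) ==ᵇ true  ∷ []

orderIso-1342⁻ : ∀ {a b c d} → T (orderIso (a ∷ b ∷ c ∷ d ∷ []) ρ) → a < d × d < b × b < c
orderIso-1342⁻ {a} {b} {c} {d} iso with all⁺ id (comparisons1342 a b c d) iso
... | _ ∷ _ ∷ _ ∷ _ ∷ _ ∷ _ ∷ _ ∷ b≰d ∷ _ ∷ c≰b ∷ _ ∷ _ ∷ d≰a ∷ _ =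
  ≤ᵇ==false⇒> d≰a , ≤ᵇ==false⇒> b≰d , ≤ᵇ==false⇒> c≰b

orderIso-1342⁺ : ∀ {a b c d} → a < d → d < b → b < c → T (orderIso (a ∷ b ∷ c ∷ d ∷ []) ρ)
orderIso-1342⁺ {a} {b} {c} {d} a<d d<b b<c = all⁻ id {comparisons1342 a b c d}
  ( ≤⇒≤ᵇ==true (≤-refl {a}) ∷ ≤⇒≤ᵇ==true (<⇒≤ a<b) ∷ ≤⇒≤ᵇ==true (<⇒≤ a<c) ∷ ≤⇒≤ᵇ==true (<⇒≤ a<d)
  ∷ >⇒≤ᵇ==false a<b ∷ ≤⇒≤ᵇ==true (≤-refl {b}) ∷ ≤⇒≤ᵇ==true (<⇒≤ b<c) ∷ >⇒≤ᵇ==false d<b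
  ∷ >⇒≤ᵇ==false a<c ∷ >⇒≤ᵇ==false b<c ∷ ≤⇒≤ᵇ==true (≤-refl {c}) ∷ >⇒≤ᵇ==false d<c
  ∷ >⇒≤ᵇ==false a<d ∷ ≤⇒≤ᵇ==true (<⇒≤ d<b) ∷ ≤⇒≤ᵇ==true (<⇒≤ d<c) ∷ ≤⇒≤ᵇ==true (≤-refl {d}) ∷ [])
  where
  a<b = <-trans a<d d<b
  d<c = <-trans d<b b<c
  a<c = <-trans a<b b<c

contains-sound : ∀ w → T (contains w ρ) → Contains1342 w
contains-sound w t with s , s∈ , iso ← find (any⁻ _ (subseqs w) t) = occurrence′ s (∈-subseqs⁻ w s∈) iso
  where
  occurrence′ : ∀ s → s ⊆ w → T (orderIso s ρ) → Contains1342 w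
  occurrence′ (a ∷ b ∷ c ∷ d ∷ []) s⊆w iso with a<d , d<b , b<c ← orderIso-1342⁻ iso =
    occurrence s⊆w a<d d<b b<c

contains-complete : ∀ w → Contains1342 w → T (contains w ρ)
contains-complete w (occurrence s⊆w a<d d<b b<c) =
  any⁺ _ (lose (∈-subseqs⁺ s⊆w) (orderIso-1342⁺ a<d d<b b<c))

Contains1342-⊆ : ∀ {w w′} → w ⊆ w′ → Contains1342 w → Contains1342 w′
Contains1342-⊆ w⊆w′ (occurrence emb a<d d<b b<c) = occurrence (⊆-trans emb w⊆w′) a<d d<b b<c

module _ {g : ℕ → ℕ} (g-mono : g Preserves _<_ ⟶ _<_) where

  g-reflects-< : ∀ {x y} → g x < g y → x < y
  g-reflects-< {x} {y} gx<gy with <-cmp x y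
  ... | tri< x<y _ _    = x<y
  ... | tri≈ _ refl _   = ⊥-elim (<-irrefl refl gx<gy)
  ... | tri> _ _ y<x    = ⊥-elim (<-asym gx<gy (g-mono y<x))

  Contains1342-map⁺ : ∀ {w} → Contains1342 w → Contains1342 (map g w)
  Contains1342-map⁺ (occurrence emb a<d d<b b<c) =
    occurrence (⊆-map⁺ g emb) (g-mono a<d) (g-mono d<b) (g-mono b<c)

  Contains1342-map⁻ : ∀ w → Contains1342 (map g w) → Contains1342 w
  Contains1342-map⁻ w (occurrence emb a<d d<b b<c) with ⊆-map⁻ g w emb
  ... | _ ∷ _ ∷ _ ∷ _ ∷ [] , emb′ , refl =
    occurrence emb′ (g-reflects-< a<d) (g-reflects-< d<b) (g-reflects-< b<c)

private
  3+a≤c : ∀ {a b c d} → a < d → d < b → b < c → 3 + a ≤ c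
  3+a≤c a<d d<b b<c = ≤-trans (s≤s (≤-trans (s≤s a<d) d<b)) b<c

  2+d≤c : ∀ {b c d} → d < b → b < c → 2 + d ≤ c
  2+d≤c d<b b<c = ≤-trans (s≤s d<b) b<c

-- x can only serve as the 1 of an occurrence and y only as its 2; either would need a letter above B.

Contains1342-unwrap : ∀ {B x y} M → Bounded B M → y ≤ B → B < 3 + x → B < 2 + y →
                      Contains1342 (x ∷ M ++ [ y ]) → Contains1342 M
Contains1342-unwrap M M≤B y≤B B<3+x _ (occurrence (refl ∷ bcd⊆) a<d d<b b<c) =
  ⊥-elim (<⇒≱ B<3+x (≤-trans (3+a≤c a<d d<b b<c) (Bounded-++[] M M≤B y≤B (lookup bcd⊆ (there (here refl))))))
Contains1342-unwrap M M≤B _ _ B<2+y (occurrence (_ ∷ʳ abcd⊆) a<d d<b b<c)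
  with ⊆-++[]⁻ (_ ∷ _ ∷ _ ∷ []) M abcd⊆
... | inj₁ abcd⊆M      = occurrence abcd⊆M a<d d<b b<c
... | inj₂ (refl , abc⊆M) =
  ⊥-elim (<⇒≱ B<2+y (≤-trans (2+d≤c d<b b<c) (M≤B (lookup abc⊆M (there (there (here refl)))))))

Contains1342-wrap : ∀ {x y M} → Contains1342 M → Contains1342 (x ∷ M ++ [ y ])
Contains1342-wrap {x} {y} = Contains1342-⊆ (x ∷ʳ ++⁺ʳ [ y ] ⊆-refl)

-- Doubled permutations

double : List ℕ → List ℕ
double π = π ++ reverse π

double-∷ : ∀ x π → double (x ∷ π) ≡ x ∷ double π ++ [ x ]
double-∷ x π =
  trans (cong (λ w → x ∷ π ++ w) (unfold-reverse x π)) (cong (x ∷_) (sym (++-assoc π (reverse π) [ x ])))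

double-∷-∷ : ∀ x y π → double (x ∷ y ∷ π) ≡ x ∷ (y ∷ double π ++ [ y ]) ++ [ x ]
double-∷-∷ x y π = trans (double-∷ x (y ∷ π)) (cong (λ w → x ∷ w ++ [ x ]) (double-∷ y π))

double-map : ∀ (g : ℕ → ℕ) π → double (map g π) ≡ map g (double π)
double-map g π = trans (cong (map g π ++_) (sym (reverse-map g π))) (sym (map-++ g π (reverse π)))

∈-double⁻ : ∀ {x} π → x ∈ double π → x ∈ π
∈-double⁻ π x∈ with ∈-++⁻ π x∈
... | inj₁ x∈π  = x∈π
... | inj₂ x∈πʳ = Any.reverse⁻ x∈πʳ

∈-∈-double : ∀ {u v π} → u ∈ π → v ∈ π → u ∷ v ∷ [] ⊆ double π
∈-∈-double u∈ v∈ = ++⁺ (from∈ u∈) (from∈ (Any.reverse⁺ v∈))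

Bounded-double : ∀ {n} π → Bounded n π → Bounded n (double π)
Bounded-double π b = b ∘ ∈-double⁻ π

χ : List ℕ → ℕ
χ π = if avoids (double π) ρ then 1 else 0

avoiders : ℕ → ℕ
avoiders n = ∑[ π ∈ perms n ] χ π

r≡avoiders : ∀ n → r n ρ ≡ avoiders n
r≡avoiders n = trans (count (map double (perms n))) (sumOver-map double (perms n) indicator)
  where
  indicator : List ℕ → ℕ
  indicator w = if avoids w ρ then 1 else 0
  count : ∀ ws → length (filter (λ w → avoids w ρ Data.Bool.≟ true) ws) ≡ sumOver ws indicator
  count []       = refl
  count (w ∷ ws) with avoids w ρ
  ... | true  = cong suc (count ws)
  ... | false = count ws

T⇔T⇒≡ : ∀ {x y} → (T x → T y) → (T y → T x) → x ≡ y
T⇔T⇒≡ {false} {false} _ _ = refl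
T⇔T⇒≡ {false} {true}  _ g = ⊥-elim (g tt)
T⇔T⇒≡ {true}  {false} f _ = ⊥-elim (f tt)
T⇔T⇒≡ {true}  {true}  _ _ = refl

χ-cong : ∀ π π′ → (Contains1342 (double π) → Contains1342 (double π′)) →
         (Contains1342 (double π′) → Contains1342 (double π)) → χ π ≡ χ π′
χ-cong π π′ f g = cong (λ b → if not b then 1 else 0)
  (T⇔T⇒≡ (contains-complete _ ∘ f ∘ contains-sound _) (contains-complete _ ∘ g ∘ contains-sound _))

χ-vanishes : ∀ π → Contains1342 (double π) → χ π ≡ 0
χ-vanishes π o with contains (double π) ρ | contains-complete (double π) o
... | true | _ = refl

χ-map : ∀ {g} → g Preserves _<_ ⟶ _<_ → ∀ π → χ (map g π) ≡ χ π
χ-map {g} g-mono π = χ-cong (map g π) π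
  (λ o → Contains1342-map⁻ g-mono (double π) (subst Contains1342 (double-map g π) o))
  (λ o → subst Contains1342 (sym (double-map g π)) (Contains1342-map⁺ g-mono o))

χ-∷ : ∀ {B x} σ → Bounded B σ → x ≤ B → B < 2 + x → χ (x ∷ σ) ≡ χ σ
χ-∷ {x = x} σ σ≤B x≤B B<2+x = χ-cong (x ∷ σ) σ
  (λ o → Contains1342-unwrap (double σ) (Bounded-double σ σ≤B) x≤B (m<n⇒m<1+n B<2+x) B<2+x
           (subst Contains1342 (double-∷ x σ) o))
  (λ o → subst Contains1342 (sym (double-∷ x σ)) (Contains1342-wrap o))

χ-◂-max : ∀ {n} σ → Bounded n σ → χ (suc n ◂ σ) ≡ χ σ
χ-◂-max {n} σ σ≤n = trans (cong χ (◂-max σ σ≤n)) (χ-∷ σ (m≤n⇒m≤1+n ∘ σ≤n) ≤-refl (m<n+m (suc n) {2} z<s))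

χ-◂-submax : ∀ {n} σ → Bounded n σ → χ (n ◂ σ) ≡ χ σ
χ-◂-submax {n} σ σ≤n =
  trans (χ-∷ (map (punchIn n) σ) (Bounded-punchIn n σ σ≤n) (n≤1+n n) (n<1+n (suc n)))
        (χ-map (punchIn-mono-< n) σ)

-- The outer k can only serve as the 2; then the 3 lies strictly between k and the 4 ≤ k + 2, so it is
-- k + 1, which occurs only at the two ends of the inner block, where no 1 precedes it or no 4 follows it.

χ-∷-suc∷ : ∀ {k} L → Bounded (2 + k) L → suc k ∉ L → χ (k ∷ suc k ∷ L) ≡ χ (suc k ∷ L)
χ-∷-suc∷ {k} L L≤ k+1∉L = χ-cong (k ∷ suc k ∷ L) (suc k ∷ L)
  (λ o → drop (subst Contains1342 (double-∷ k (suc k ∷ L)) o))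
  (λ o → subst Contains1342 (sym (double-∷ k (suc k ∷ L))) (Contains1342-wrap o))
  where
  M = double (suc k ∷ L)
  M≤ : Bounded (2 + k) (M ++ [ k ])
  M≤ = Bounded-++[] M (Bounded-double (suc k ∷ L) λ { (here refl) → n≤1+n _ ; (there x∈) → L≤ x∈ })
                    (m≤n⇒m≤1+n (n≤1+n k))
  drop : Contains1342 (k ∷ M ++ [ k ]) → Contains1342 M
  drop (occurrence (refl ∷ bcd⊆) a<d d<b b<c) =
    ⊥-elim (<⇒≱ (n<1+n (2 + k)) (≤-trans (3+a≤c a<d d<b b<c) (M≤ (lookup bcd⊆ (there (here refl))))))
  drop (occurrence {a} {b} {c} (_ ∷ʳ abcd⊆) a<d d<b b<c) with ⊆-++[]⁻ (_ ∷ _ ∷ _ ∷ []) M abcd⊆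
  ... | inj₁ abcd⊆M = occurrence abcd⊆M a<d d<b b<c
  ... | inj₂ (refl , abc⊆M) with subst (a ∷ b ∷ c ∷ [] ⊆_) (double-∷ (suc k) L) abc⊆M
  ...   | refl ∷ _    = ⊥-elim (<-asym a<d (n<1+n k))
  ...   | _ ∷ʳ abc⊆ with ⊆-++[]⁻ (_ ∷ _ ∷ []) (double L) abc⊆
  ...     | inj₂ (refl , _) = ⊥-elim (<⇒≱ d<b (≤-pred b<c))
  ...     | inj₁ abc⊆DL    = ⊥-elim (k+1∉L (subst (_∈ L) b≡1+k (∈-double⁻ L b∈)))
    where
    b∈ : b ∈ double L
    b∈ = lookup abc⊆DL (there (here refl))
    c∈ : c ∈ double L
    c∈ = lookup abc⊆DL (there (there (here refl)))
    b≡1+k : b ≡ suc k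
    b≡1+k = ≤-antisym (≤-pred (≤-trans b<c (L≤ (∈-double⁻ L c∈)))) d<b

χ-◂◂ : ∀ {k} σ → Bounded k σ → χ (k ◂ k ◂ σ) ≡ χ σ
χ-◂◂ {k} σ σ≤k = begin
  χ (k ◂ k ◂ σ)         ≡⟨ cong (λ x → χ (k ∷ x ∷ L)) (punchIn-≥ (≤-refl {k})) ⟩
  χ (k ∷ suc k ∷ L)     ≡⟨ χ-∷-suc∷ L L≤ k+1∉L ⟩
  χ (suc k ∷ L)         ≡⟨ χ-∷ L L≤ (n≤1+n _) ≤-refl ⟩
  χ L                   ≡⟨ χ-map (punchIn-mono-< k) (map (punchIn k) σ) ⟩
  χ (map (punchIn k) σ) ≡⟨ χ-map (punchIn-mono-< k) σ ⟩
  χ σ                   ∎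
  where
  open ≡-Reasoning
  L = map (punchIn k) (map (punchIn k) σ)
  L≤ : Bounded (2 + k) L
  L≤ = Bounded-punchIn k _ (Bounded-punchIn k σ σ≤k)
  k+1∉L : suc k ∉ L
  k+1∉L k+1∈ with y , y∈ , eq ← ∈-map⁻ (punchIn k) k+1∈ with x , _ , refl ← ∈-map⁻ (punchIn k) y∈ =
    punchIn²-≢-suc k x (sym eq)

-- By positivity the outer 1s can only serve as the 1 of an occurrence, and by maximality the copies of m
-- only as its 4, which their places at the ends of the inner block rule out.

χ-1∷-max : ∀ {k} Y → Bounded (suc k) Y → Positive Y → χ (1 ∷ suc k ∷ Y) ≡ χ (1 ∷ Y)
χ-1∷-max {k} Y Y≤m Y>0 = χ-cong (1 ∷ m ∷ Y) (1 ∷ Y)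
  (λ o → subst Contains1342 (sym (double-∷ 1 Y)) (drop (subst Contains1342 (double-∷-∷ 1 m Y) o)))
  (λ o → subst Contains1342 (sym (double-∷-∷ 1 m Y))
           (Contains1342-⊆ (refl ∷ ++⁺ (m ∷ʳ ++⁺ʳ [ m ] ⊆-refl) (refl ∷ []))
             (subst Contains1342 (double-∷ 1 Y) o)))
  where
  m = suc k
  DY≤m : Bounded m (double Y)
  DY≤m = Bounded-double Y Y≤m
  M≤m : Bounded m (m ∷ double Y ++ [ m ])
  M≤m (here refl) = ≤-refl
  M≤m (there x∈)  = Bounded-++[] (double Y) DY≤m ≤-refl x∈
  M>0 : Positive (m ∷ double Y ++ [ m ])
  M>0 (here refl) = s≤s z≤n
  M>0 (there x∈) with ∈-++⁻ (double Y) x∈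
  ... | inj₁ x∈DY      = Y>0 (∈-double⁻ Y x∈DY)
  ... | inj₂ (here refl) = s≤s z≤n
  drop : Contains1342 (1 ∷ (m ∷ double Y ++ [ m ]) ++ [ 1 ]) → Contains1342 (1 ∷ double Y ++ [ 1 ])
  drop (occurrence (refl ∷ bcd⊆) a<d d<b b<c) with ⊆-++[]⁻ (_ ∷ _ ∷ []) (m ∷ double Y ++ [ m ]) bcd⊆
  ... | inj₂ (refl , _) = ⊥-elim (<-irrefl refl a<d)
  ... | inj₁ (refl ∷ cd⊆) = ⊥-elim (<⇒≱ b<c (M≤m (there (lookup cd⊆ (here refl)))))
  ... | inj₁ (_ ∷ʳ bcd⊆′) with ⊆-++[]⁻ (_ ∷ _ ∷ []) (double Y) bcd⊆′
  ...   | inj₂ (refl , bc⊆) =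
    ⊥-elim (<⇒≱ (m<n+m m {2} z<s) (≤-trans (2+d≤c d<b b<c) (DY≤m (lookup bc⊆ (there (here refl))))))
  ...   | inj₁ bcd⊆DY       = occurrence (refl ∷ ++⁺ʳ [ 1 ] bcd⊆DY) a<d d<b b<c
  drop (occurrence (_ ∷ʳ abcd⊆) a<d d<b b<c) with ⊆-++[]⁻ (_ ∷ _ ∷ _ ∷ []) (m ∷ double Y ++ [ m ]) abcd⊆
  ... | inj₂ (refl , abc⊆) = ⊥-elim (<⇒≱ a<d (M>0 (lookup abc⊆ (here refl))))
  ... | inj₁ abcd⊆M        = Contains1342-wrap (Contains1342-unwrap (double Y) DY≤m ≤-refl
                               (m<n+m m {3} z<s) (m<n+m m {2} z<s) (occurrence abcd⊆M a<d d<b b<c))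

χ-1◂-max : ∀ {k} σ → Bounded k σ → Positive σ → χ (1 ◂ suc k ◂ σ) ≡ χ (1 ◂ σ)
χ-1◂-max σ σ≤k σ>0 =
  trans (cong₂ (λ x τ → χ (1 ∷ x ∷ map (punchIn 1) τ)) (punchIn-≥ (s≤s z≤n)) (map-punchIn-id σ σ≤k))
        (χ-1∷-max (map (punchIn 1) σ) (m≤n⇒m≤1+n ∘ Bounded-punchIn 1 σ σ≤k) Y>0)
  where
  Y>0 : Positive (map (punchIn 1) σ)
  Y>0 x∈ with x , x∈σ , refl ← ∈-map⁻ (punchIn 1) x∈ = subst (1 ≤_) (sym (punchIn-≥ (σ>0 x∈σ))) (s≤s z≤n)

-- Forced occurrences

k◂1+k◂-contains : ∀ {k σ} → 2 ≤ k → Covers k σ → Contains1342 (double (k ◂ suc k ◂ σ))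
k◂1+k◂-contains {k} {σ} 2≤k covers = subst Contains1342 (sym (double-∷-∷ k y L))
  (occurrence (k ∷ʳ ++⁺ (y ∷ʳ ++⁺ (∈-∈-double u∈ v∈) (refl ∷ [])) (refl ∷ [])) u<k k<v v<y)
  where
  1≤k = ≤-trans (n≤1+n 1) 2≤k
  y = punchIn k (suc k)
  L = map (punchIn k) (map (punchIn (suc k)) σ)
  u = punchIn k (punchIn (suc k) 1)
  v = punchIn k (punchIn (suc k) k)
  u∈ : u ∈ L
  u∈ = ∈-map⁺ _ (∈-map⁺ _ (covers ≤-refl 1≤k))
  v∈ : v ∈ L
  v∈ = ∈-map⁺ _ (∈-map⁺ _ (covers 1≤k ≤-refl))
  u<k : u < k
  u<k rewrite punchIn-< {suc k} {1} (s≤s 1≤k) | punchIn-< {k} {1} 2≤k = 2≤k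
  k<v : k < v
  k<v rewrite punchIn-< {suc k} {k} ≤-refl | punchIn-≥ (≤-refl {k}) = ≤-refl
  v<y : v < y
  v<y rewrite punchIn-< {suc k} {k} ≤-refl | punchIn-≥ (≤-refl {k}) | punchIn-≥ (n≤1+n k) = ≤-refl

k◂f◂-contains : ∀ {k f σ} → 1 ≤ f → f < k → Covers k σ → Contains1342 (double (k ◂ f ◂ σ))
k◂f◂-contains {suc j} {f} {σ} 1≤f (s≤s f≤j) covers = subst Contains1342 (sym (double-∷-∷ (suc j) y L))
  (occurrence (suc j ∷ʳ ++⁺ (refl ∷ ++⁺ʳ [ y ] (∈-∈-double u∈ v∈)) (refl ∷ [])) y<1+j 1+j<u u<v)
  where
  y = punchIn (suc j) f
  L = map (punchIn (suc j)) (map (punchIn f) σ)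
  u = punchIn (suc j) (punchIn f j)
  v = punchIn (suc j) (punchIn f (suc j))
  u∈ : u ∈ L
  u∈ = ∈-map⁺ _ (∈-map⁺ _ (covers (≤-trans 1≤f f≤j) (n≤1+n j)))
  v∈ : v ∈ L
  v∈ = ∈-map⁺ _ (∈-map⁺ _ (covers (s≤s z≤n) ≤-refl))
  y<1+j : y < suc j
  y<1+j rewrite punchIn-< {suc j} {f} (s≤s f≤j) = s≤s f≤j
  1+j<u : suc j < u
  1+j<u rewrite punchIn-≥ f≤j | punchIn-≥ (≤-refl {suc j}) = ≤-refl
  u<v : u < v
  u<v = punchIn-mono-< (suc j) (punchIn-mono-< f (n<1+n j))

f◂-contains : ∀ {q f σ} → 2 ≤ f → f ≤ q → Covers (2 + q) σ → Contains1342 (double (f ◂ σ))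
f◂-contains {q} {f} {σ} 2≤f f≤q covers =
  subst Contains1342 (sym (double-∷ f L)) ([ vw-in-order , wv-in-order ]′ (∈-∈-ordered v∈ w∈ (<⇒≢ v<w)))
  where
  L = map (punchIn f) σ
  t = punchIn f 1
  u = punchIn f q
  v = punchIn f (suc q)
  w = punchIn f (2 + q)
  t∈ : t ∈ L
  t∈ = ∈-map⁺ _ (covers ≤-refl (s≤s z≤n))
  u∈ : u ∈ L
  u∈ = ∈-map⁺ _ (covers (≤-trans (≤-trans (n≤1+n 1) 2≤f) f≤q) (m≤n⇒m≤1+n (n≤1+n q)))
  v∈ : v ∈ L
  v∈ = ∈-map⁺ _ (covers (s≤s z≤n) (n≤1+n _))
  w∈ : w ∈ L
  w∈ = ∈-map⁺ _ (covers (s≤s z≤n) ≤-refl)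
  t<f : t < f
  t<f rewrite punchIn-< {f} {1} 2≤f = 2≤f
  f<u : f < u
  f<u rewrite punchIn-≥ f≤q = s≤s f≤q
  u<v : u < v
  u<v = punchIn-mono-< f (n<1+n q)
  v<w : v < w
  v<w = punchIn-mono-< f (n<1+n (suc q))
  vw-in-order : v ∷ w ∷ [] ⊆ L → Contains1342 (f ∷ double L ++ [ f ])
  vw-in-order vw⊆L = occurrence (refl ∷ ++⁺ʳ [ f ] (++⁺ vw⊆L (from∈ (Any.reverse⁺ u∈)))) f<u u<v v<w
  wv-in-order : w ∷ v ∷ [] ⊆ L → Contains1342 (f ∷ double L ++ [ f ])
  wv-in-order wv⊆L = occurrence (f ∷ʳ ++⁺ (++⁺ (from∈ t∈) (⊆-reverse⁺ wv⊆L)) (refl ∷ []))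
                                t<f (<-trans f<u u<v) v<w

1◂f◂-contains : ∀ {k f σ} → 1 ≤ f → f < k → Covers k σ → Contains1342 (double (1 ◂ f ◂ σ))
1◂f◂-contains {suc j} {f} {σ} 1≤f (s≤s f≤j) covers = subst Contains1342 (sym (double-∷-∷ 1 y L))
  (occurrence (refl ∷ ++⁺ʳ [ 1 ] (y ∷ʳ ++⁺ (∈-∈-double u∈ v∈) (refl ∷ []))) 1<y y<u u<v)
  where
  y = punchIn 1 f
  L = map (punchIn 1) (map (punchIn f) σ)
  u = punchIn 1 (punchIn f j)
  v = punchIn 1 (punchIn f (suc j))
  u∈ : u ∈ L
  u∈ = ∈-map⁺ _ (∈-map⁺ _ (covers (≤-trans 1≤f f≤j) (n≤1+n j)))
  v∈ : v ∈ L
  v∈ = ∈-map⁺ _ (∈-map⁺ _ (covers (s≤s z≤n) ≤-refl))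
  1<y : 1 < y
  1<y rewrite punchIn-≥ 1≤f = s≤s 1≤f
  y<u : y < u
  y<u = punchIn-mono-< 1 (subst (f <_) (sym (punchIn-≥ f≤j)) (s≤s f≤j))
  u<v : u < v
  u<v = punchIn-mono-< 1 (punchIn-mono-< f (n<1+n j))

1◂k◂-contains : ∀ {k σ} → 2 ≤ k → Covers k σ → Contains1342 (double (1 ◂ k ◂ σ))
1◂k◂-contains {k} {σ} 2≤k covers = subst Contains1342 (sym (double-∷-∷ 1 y L))
  (occurrence (refl ∷ ++⁺ʳ [ 1 ] (refl ∷ ++⁺ʳ [ y ] (∈-∈-double u∈ v∈))) 1<v v<y y<u)
  where
  1≤k = ≤-trans (n≤1+n 1) 2≤k
  y = punchIn 1 k
  L = map (punchIn 1) (map (punchIn k) σ)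
  u = punchIn 1 (punchIn k k)
  v = punchIn 1 (punchIn k 1)
  u∈ : u ∈ L
  u∈ = ∈-map⁺ _ (∈-map⁺ _ (covers 1≤k ≤-refl))
  v∈ : v ∈ L
  v∈ = ∈-map⁺ _ (∈-map⁺ _ (covers ≤-refl 1≤k))
  1<v : 1 < v
  1<v rewrite punchIn-< {k} {1} 2≤k = ≤-refl
  v<y : v < y
  v<y rewrite punchIn-< {k} {1} 2≤k | punchIn-≥ 1≤k = s≤s 2≤k
  y<u : y < u
  y<u = punchIn-mono-< 1 (subst (k <_) (sym (punchIn-≥ (≤-refl {k}))) ≤-refl)

-- Counting

∑χ-1◂ : ∀ k → 3 ≤ k → ∑[ σ ∈ perms k ] χ (1 ◂ σ) ≡ 2
∑χ-1◂ k 3≤k with m≤n⇒m<n∨m≡n 3≤k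
... | inj₂ refl = refl
∑χ-1◂ (suc k) _ | inj₁ (s≤s 3≤k) = begin
  ∑[ σ ∈ perms (suc k) ] χ (1 ◂ σ)              ≡⟨ sumOver-perms-suc k (λ σ → χ (1 ◂ σ)) ⟩
  sumTo k F + ∑[ σ ∈ perms k ] χ (1 ◂ suc k ◂ σ) ≡⟨ cong₂ _+_ (sumTo-zero k F≡0) (sumOver-cong (perms k) max) ⟩
  0 + ∑[ σ ∈ perms k ] χ (1 ◂ σ)                 ≡⟨ ∑χ-1◂ k 3≤k ⟩
  2                                              ∎
  where
  open ≡-Reasoning
  F : ℕ → ℕ
  F f = ∑[ σ ∈ perms k ] χ (1 ◂ f ◂ σ)
  F≡0 : ∀ {f} → 1 ≤ f → f ≤ k → F f ≡ 0
  F≡0 {f} 1≤f f≤k = sumOver-zero (perms k) (λ {σ} σ∈ → χ-vanishes (1 ◂ f ◂ σ) (occurs (perms-covers k σ∈)))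
    where
    occurs : ∀ {σ} → Covers k σ → Contains1342 (double (1 ◂ f ◂ σ))
    occurs with m≤n⇒m<n∨m≡n f≤k
    ... | inj₁ f<k  = 1◂f◂-contains 1≤f f<k
    ... | inj₂ refl = 1◂k◂-contains (≤-trans (n≤1+n 2) 3≤k)
  max : ∀ {σ} → σ ∈ perms k → χ (1 ◂ suc k ◂ σ) ≡ χ (1 ◂ σ)
  max σ∈ = χ-1◂-max _ (perms-bounded k σ∈) (perms-positive k σ∈)

∑χ-k◂ : ∀ k → 2 ≤ k → ∑[ σ ∈ perms (suc k) ] χ (k ◂ σ) ≡ avoiders k
∑χ-k◂ (suc j) 2≤k = begin
  ∑[ σ ∈ perms (suc k) ] χ (k ◂ σ) ≡⟨ sumOver-perms-suc k (λ σ → χ (k ◂ σ)) ⟩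
  sumTo j G + G k + G (suc k)      ≡⟨ cong₂ _+_ (cong₂ _+_ (sumTo-zero j G≡0) (sumOver-cong (perms k) twice))
                                                (sumOver-zero (perms k) max) ⟩
  avoiders k + 0                   ≡⟨ +-identityʳ _ ⟩
  avoiders k                       ∎
  where
  open ≡-Reasoning
  k = suc j
  G : ℕ → ℕ
  G g = ∑[ σ ∈ perms k ] χ (k ◂ g ◂ σ)
  G≡0 : ∀ {g} → 1 ≤ g → g ≤ j → G g ≡ 0
  G≡0 {g} 1≤g g≤j = sumOver-zero (perms k)
    (λ {σ} σ∈ → χ-vanishes (k ◂ g ◂ σ) (k◂f◂-contains 1≤g (s≤s g≤j) (perms-covers k σ∈)))
  twice : ∀ {σ} → σ ∈ perms k → χ (k ◂ k ◂ σ) ≡ χ σ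
  twice σ∈ = χ-◂◂ _ (perms-bounded k σ∈)
  max : ∀ {σ} → σ ∈ perms k → χ (k ◂ suc k ◂ σ) ≡ 0
  max {σ} σ∈ = χ-vanishes (k ◂ suc k ◂ σ) (k◂1+k◂-contains 2≤k (perms-covers k σ∈))

avoiders-recurrence : ∀ i → avoiders (4 + i) ≡ 2 * avoiders (3 + i) + avoiders (2 + i) + 2
avoiders-recurrence i = begin
  avoiders (suc n)
    ≡⟨ sumOver-perms-suc n χ ⟩
  sumTo (suc i) F + F k + F n + F (suc n)
    ≡⟨ cong₂ _+_ (cong₂ _+_ (cong₂ _+_ F-head (∑χ-k◂ k (s≤s (s≤s z≤n)))) (sumOver-cong (perms n) submax))
                 (sumOver-cong (perms n) max) ⟩
  2 + avoiders k + avoiders n + avoiders n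
    ≡⟨ solve 2 (λ x y → con 2 :+ y :+ x :+ x := con 2 :* x :+ y :+ con 2) refl (avoiders n) (avoiders k) ⟩
  2 * avoiders n + avoiders k + 2 ∎
  where
  open ≡-Reasoning
  k = 2 + i
  n = 3 + i
  F : ℕ → ℕ
  F f = ∑[ σ ∈ perms n ] χ (f ◂ σ)
  F-head : sumTo (suc i) F ≡ 2
  F-head = trans (sumTo-head i (λ {f} 2≤f f≤1+i → sumOver-zero (perms n)
                   (λ {σ} σ∈ → χ-vanishes (f ◂ σ) (f◂-contains 2≤f f≤1+i (perms-covers n σ∈)))))
                 (∑χ-1◂ n (s≤s (s≤s (s≤s z≤n))))
  submax : ∀ {σ} → σ ∈ perms n → χ (n ◂ σ) ≡ χ σ
  submax σ∈ = χ-◂-submax _ (perms-bounded n σ∈)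
  max : ∀ {σ} → σ ∈ perms n → χ (suc n ◂ σ) ≡ χ σ
  max σ∈ = χ-◂-max _ (perms-bounded n σ∈)

theorem14 : (n : ℕ) → 4 ≤ n →
    r n (1 ∷ 3 ∷ 4 ∷ 2 ∷ []) ≡ 2 * r (n Data.Nat.∸ 1) (1 ∷ 3 ∷ 4 ∷ 2 ∷ []) + r (n Data.Nat.∸ 2) (1 ∷ 3 ∷ 4 ∷ 2 ∷ []) + 2
theorem14 (suc (suc (suc (suc i)))) (s≤s (s≤s (s≤s (s≤s z≤n)))) = begin
  r (4 + i) ρ
    ≡⟨ r≡avoiders (4 + i) ⟩
  avoiders (4 + i)
    ≡⟨ avoiders-recurrence i ⟩
  2 * avoiders (3 + i) + avoiders (2 + i) + 2
    ≡⟨ cong₂ (λ x y → 2 * x + y + 2) (r≡avoiders (3 + i)) (r≡avoiders (2 + i)) ⟨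
  2 * r (3 + i) ρ + r (2 + i) ρ + 2 ∎
  where open ≡-Reasoning
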